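{- For every Boolean function $F$, $$\mathsf{fw}(F) \leq 2^{(\mathsf{ctw}(F)+2)\,2^{\mathsf{ctw}(F)+1}}.$$
   Context: A Boolean function over a finite set of variables $X$ is a map $F\colon\{0,1\}^X\to\{0,1\}$; $\mathsf{sat}(F)=F^{ -1}(1)$. For a set of variables $Y$ and assignments $b\colon Y\cap X\to\{0,1\}$, $b'\colon X\setminus Y\to\{0,1\}$, write $F(b,b')=F(b\cup b')$. The cofactor of $F$ induced by $b\colon Y\cap X\to\{0,1\}$ is the function $F(b,X\setminus Y)\colon\{0,1\}^{X\setminus Y}\to\{0,1\}$, $b'\mapsto F(b,b')$. A function $G\colon\{0,1\}^{Y\cap X}\to\{0,1\}$ is a factor of $F$ relative to $Y$ if there is a cofactor $F'$ of $F$ induced by some assignment of $Y\cap X$ such that for all $b\colon Y\cap X\to\{0,1\}$: $G(b)=1$ iff $F(b,X\setminus Y)=F'$. $\mathsf{factors}(F,Y)$ denotes the set of factors of $F$ relative to $Y$. A vtree for a finite nonempty set of variables $Z$ is a rooted, ordered binary tree (not necessarily full) whose leaves are in bijection with $Z$ (leaves are identified with variables); for a node $v$, $Z_v$ is the set of leaves of the subtree rooted at $v$. For $F$ over $X$ and a vtree $T$ for a set $Z\supseteq X$, $\mathsf{fw}(F,T)=\max_{v\in T}|\mathsf{factors}(F,Z_v)|$, and the factor width is $\mathsf{fw}(F)=\min\{\mathsf{fw}(F,T): T \text{ vtree for some } Z\supseteq X\}$. A circuit over $X$ is a DAG whose source nodes (input gates) are labelled by pairwise distinct variables of $X$ or constants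 $\bot,\top$, whose other nodes are unbounded-fanin $\wedge$/$\vee$ gates or fanin-1 $\neg$ gates, with a designated output gate; it computes a Boolean function over $X$ in the usual way. The treewidth of a circuit is the treewidth of the undirected graph underlying its DAG, and the circuit treewidth $\mathsf{ctw}(F)$ is the minimum treewidth of a circuit computing $F$. -}

module Defs where

open import Data.Nat using (ℕ; zero; suc; _≤_)
import Data.Nat as ℕ
open import Data.Bool using (Bool; true; false; if_then_else_; not)
open import Data.Fin using (Fin; zero; suc)
open import Data.Fin.Subset using (Subset; ∣_∣) renaming (_∈_ to _∈ₛ_; _∉_ to _∉ₛ_)
open import Data.List using (List; []; _∷_; length; _++_)
open import Data.Bool.ListAction using (all; any)
open import Data.List.NonEmpty using (List⁺; toList)
open import Data.List.Membership.Propositional using (_∈_)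
open import Data.List.Membership.DecPropositional ℕ._≟_ using (_∈?_)
open import Data.List.Relation.Unary.Any using (Any)
open import Data.List.Relation.Unary.All using (All)
open import Data.List.Relation.Unary.Unique.Propositional using (Unique)
open import Data.Product using (Σ; _×_; _,_)
open import Data.Sum using (_⊎_)
open import Data.Unit using (⊤)
open import Relation.Nullary using (¬_; does)
open import Relation.Binary.PropositionalEquality using (_≡_)

-- A Boolean function over the finite
-- variable set X (given as a list) is encoded as a map from total
-- assignments ℕ → Bool to Bool that depends only on the variables of X
-- (see DependsOnly).  Assignments of a subset are likewise represented
-- by total assignments; only their restriction matters.

Assignment : Set
Assignment = ℕ → Bool

BoolFun : Set
BoolFun = Assignment → Bool

DependsOnly : List ℕ → BoolFun → Set
DependsOnly X F = ∀ α β → (∀ x → x ∈ X → α x ≡ β x) → F α ≡ F β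

merge : List ℕ → Assignment → Assignment → Assignment
merge Y α γ x = if does (x ∈? Y) then α x else γ x

-- The cofactors F(α|Y∩X , X∖Y) and F(β|Y∩X , X∖Y) are equal.
SameCofactor : BoolFun → List ℕ → Assignment → Assignment → Set
SameCofactor F Y α β = ∀ γ → F (merge Y α γ) ≡ F (merge Y β γ)

IsFactor : BoolFun → List ℕ → BoolFun → Set
IsFactor F Y G = Σ Assignment λ α₀ → ∀ β →
  (G β ≡ true → SameCofactor F Y β α₀) × (SameCofactor F Y β α₀ → G β ≡ true)

AtMost : ℕ → (BoolFun → Set) → Set
AtMost N P = Σ (List BoolFun) λ L → length L ≤ N ×
  (∀ G → P G → Any (λ H → ∀ β → G β ≡ H β) L)

data VTree : Set where
  leaf  : ℕ → VTree
  node₁ : VTree → VTree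
  node₂ : VTree → VTree → VTree

leaves : VTree → List ℕ
leaves (leaf x)    = x ∷ []
leaves (node₁ t)   = leaves t
leaves (node₂ t u) = leaves t ++ leaves u

-- v is (the subtree rooted at) a node of t
data _⊑_ : VTree → VTree → Set where
  here : ∀ {t} → t ⊑ t
  in₁  : ∀ {v t} → v ⊑ t → v ⊑ node₁ t
  inˡ  : ∀ {v t u} → v ⊑ t → v ⊑ node₂ t u
  inʳ  : ∀ {v t u} → v ⊑ u → v ⊑ node₂ t u

-- fw(F, T) ≤ N, where T is a vtree for Z = leaves T ⊇ X
-- (Unique: leaves are in bijection with Z).
FwTreeAtMost : List ℕ → BoolFun → VTree → ℕ → Set
FwTreeAtMost X F T N =
  Unique (leaves T) × (∀ x → x ∈ X → x ∈ leaves T) ×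
  (∀ v → v ⊑ T → AtMost N (IsFactor F (leaves v)))

FwAtMost : List ℕ → BoolFun → ℕ → Set
FwAtMost X F N = Σ VTree λ T → FwTreeAtMost X F T N

-- Circuits.  Gates are numbered 0 … n-1; gate i may only take inputs from
-- gates j > i (this is a topological order, so every DAG is representable).

data Gate (n : ℕ) : Set where
  var   : ℕ → Gate n
  const : Bool → Gate n
  ∧g    : List⁺ (Fin n) → Gate n
  ∨g    : List⁺ (Fin n) → Gate n
  ¬g    : Fin n → Gate n

-- gates (g ∷ gs): g is gate 0 and its inputs i refer to gate suc i.
data Gates : ℕ → Set where
  []  : Gates zero
  _∷_ : ∀ {n} → Gate n → Gates n → Gates (suc n)

inputs : ∀ {n} → Gate n → List (Fin n)
inputs (var x)   = []
inputs (const b) = []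
inputs (∧g l)    = toList l
inputs (¬g i)    = i ∷ []
inputs (∨g l)    = toList l

evalGate : ∀ {n} → Gate n → Assignment → (Fin n → Bool) → Bool
evalGate (var x)   α v = α x
evalGate (const b) α v = b
evalGate (∧g l)    α v = all v (toList l)
evalGate (∨g l)    α v = any v (toList l)
evalGate (¬g i)    α v = not (v i)

value : ∀ {n} → Gates n → Assignment → Fin n → Bool
value (g ∷ gs) α zero    = evalGate g α (value gs α)
value (g ∷ gs) α (suc i) = value gs α i

record Circuit : Set where
  field
    size   : ℕ
    gates  : Gates size
    output : Fin size
open Circuit public

data IsVar : ∀ {n} → Gates n → Fin n → ℕ → Set where
  here  : ∀ {n x} {gs : Gates n} → IsVar (var x ∷ gs) zero x
  there : ∀ {n x i} {g : Gate n} {gs : Gates n} → IsVar gs i x → IsVar (g ∷ gs) (suc i) x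

data Wire : ∀ {n} → Gates n → Fin n → Fin n → Set where
  here  : ∀ {n j} {g : Gate n} {gs : Gates n} → j ∈ inputs g → Wire (g ∷ gs) zero (suc j)
  there : ∀ {n i j} {g : Gate n} {gs : Gates n} → Wire gs i j → Wire (g ∷ gs) (suc i) (suc j)

CircuitOver : List ℕ → Circuit → Set
CircuitOver X C =
  (∀ i j x → IsVar (gates C) i x → IsVar (gates C) j x → i ≡ j) ×
  (∀ i x → IsVar (gates C) i x → x ∈ X)

Computes : Circuit → BoolFun → Set
Computes C F = ∀ α → value (gates C) α (output C) ≡ F α

Adj : (C : Circuit) → Fin (size C) → Fin (size C) → Set
Adj C i j = Wire (gates C) i j ⊎ Wire (gates C) j i

data TD (n : ℕ) : Set where
  node : Subset n → List (TD n) → TD n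

root : ∀ {n} → TD n → Subset n
root (node B ts) = B

mutual
  bags : ∀ {n} → TD n → List (Subset n)
  bags (node B ts) = B ∷ bagsList ts

  bagsList : ∀ {n} → List (TD n) → List (Subset n)
  bagsList []       = []
  bagsList (t ∷ ts) = bags t ++ bagsList ts

Occurs : ∀ {n} → Fin n → TD n → Set
Occurs v t = Any (v ∈ₛ_) (bags t)

AtMostOne : ∀ {A : Set} → (A → Set) → List A → Set
AtMostOne P []       = ⊤
AtMostOne P (x ∷ xs) = (P x → All (λ y → ¬ P y) xs) × AtMostOne P xs

-- the nodes whose bags contain v induce a connected subtree
mutual
  Connected : ∀ {n} → Fin n → TD n → Set
  Connected v (node B ts) =
    ConnectedAll v ts ×
    (v ∈ₛ B → All (λ c → Occurs v c → v ∈ₛ root c) ts) ×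
    (v ∉ₛ B → AtMostOne (Occurs v) ts)

  ConnectedAll : ∀ {n} → Fin n → List (TD n) → Set
  ConnectedAll v []       = ⊤
  ConnectedAll v (t ∷ ts) = Connected v t × ConnectedAll v ts

TreeDecWidthAtMost : (C : Circuit) → TD (size C) → ℕ → Set
TreeDecWidthAtMost C D k =
  (∀ v → Occurs v D) ×
  (∀ i j → Adj C i j → Any (λ B → i ∈ₛ B × j ∈ₛ B) (bags D)) ×
  (∀ v → Connected v D) ×
  All (λ B → ∣ B ∣ ≤ suc k) (bags D)

module Submission where

-- Build a vtree from a tree decomposition of width k of a circuit C for F: every decomposition
-- node contributes a comb whose teeth are the variable gates entering its bag B, followed by the
-- combs of its children.  The leaves below any node of this vtree are the variables of a set S of
-- gates all of whose neighbours outside S lie in the single bag B, hence among at most k + 1 gates.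
-- The cofactor induced by an assignment of these variables is then determined by a table giving,
-- for each of the 2^(k+1) valuations of the boundary gates, the value S gives to the output and
-- what it contributes to each boundary gate.  There are at most 2^((k+2)·2^(k+1)) such tables.

open import Defs
open import Data.Bool using (Bool; true; false; not; if_then_else_; _∧_; _∨_)
import Data.Bool as Bool
open import Data.Bool.ListAction using (and; or; all; any)
open import Data.Bool.Properties using (⇔→≡)
import Data.Bool.Properties as Bool
open import Data.Empty using (⊥)
open import Data.Fin using (Fin; zero; suc)
import Data.Fin as Fin
open import Data.Fin.Subset using (Subset; ∣_∣) renaming (_∈_ to _∈ₛ_; _∉_ to _∉ₛ_; ⊥ to ∅)
open import Data.Fin.Subset.Properties using (∉⊥) renaming (_∈?_ to _∈ₛ?_)
open import Data.List using (List; []; _∷_; _++_; length; map; filter; allFin; deduplicate; cartesianProductWith)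
open import Data.List.Membership.Propositional using (_∈_; lose; find)
open import Data.List.Membership.Propositional.Properties
  using ( ∈-cartesianProductWith⁺; ∈-map⁺; ∈-map⁻; ∈-++⁺ˡ; ∈-++⁺ʳ; ∈-++⁻; ∈-filter⁺; ∈-filter⁻; ∈-allFin
        ; ∈-deduplicate⁺; ∈-deduplicate⁻)
open import Data.List.NonEmpty using (toList)
open import Data.List.Properties using (length-++; length-map)
import Data.List.Properties as List
open import Data.List.Relation.Binary.Disjoint.Propositional using (Disjoint)
open import Data.List.Relation.Unary.All using (All; []; _∷_)
import Data.List.Relation.Unary.All as All
import Data.List.Relation.Unary.All.Properties as AllP
open import Data.List.Relation.Unary.AllPairs using ([]; _∷_)
open import Data.List.Relation.Unary.Any using (Any; here; there; satisfied)
import Data.List.Relation.Unary.Any as Any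
import Data.List.Relation.Unary.Any.Properties as Any
open import Data.List.Relation.Unary.Unique.DecPropositional.Properties using (deduplicate-!)
open import Data.List.Relation.Unary.Unique.Propositional using (Unique)
import Data.List.Relation.Unary.Unique.Propositional.Properties as Unique
open import Data.Maybe using (Maybe; just; nothing; fromMaybe)
import Data.Maybe.Properties as Maybe
open import Data.Nat using (ℕ; zero; suc; _+_; _*_; _^_; _≤_)
import Data.Nat as ℕ
import Data.Nat.Properties as ℕ
open import Data.List.Membership.DecPropositional ℕ._≟_ using (_∈?_)
open import Data.Product using (Σ; ∃-syntax; _×_; _,_; proj₁; proj₂)
open import Data.Sum using (_⊎_; inj₁; inj₂)
open import Data.Unit using (⊤; tt)
open import Data.Vec using ([]; _∷_; here; there)
open import Function using (_∘_; _⇔_; mk⇔; Equivalence)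
open import Relation.Binary.Definitions using (DecidableEquality; Decidable)
open import Relation.Binary.PropositionalEquality
  using (_≡_; refl; sym; trans; cong; cong₂; subst; module ≡-Reasoning)
open import Relation.Nullary using (Dec; yes; no; does; ¬_; ¬?; _×-dec_; _⊎-dec_; contradiction)
open import Relation.Nullary.Decidable using (dec-true; dec-false; does-⇔; map′)

does-true⇒ : ∀ {P : Set} (P? : Dec P) → does P? ≡ true → P
does-true⇒ (yes p) _ = p

does-false⇒ : ∀ {P : Set} (P? : Dec P) → does P? ≡ false → ¬ P
does-false⇒ (no ¬p) _ = ¬p

map-≡⇒pointwise : ∀ {A B : Set} {f g : A → B} {x} xs → map f xs ≡ map g xs → x ∈ xs → f x ≡ g x
map-≡⇒pointwise (_ ∷ xs) eq (here refl) = proj₁ (List.∷-injective eq)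
map-≡⇒pointwise (_ ∷ xs) eq (there x∈) = map-≡⇒pointwise xs (proj₂ (List.∷-injective eq)) x∈

Unique-map⁺ : ∀ {A B : Set} {f : A → B} {xs} → (∀ {x y} → x ∈ xs → y ∈ xs → f x ≡ f y → x ≡ y) →
  Unique xs → Unique (map f xs)
Unique-map⁺ {xs = []}     f-inj []          = []
Unique-map⁺ {xs = x ∷ xs} f-inj (x∉ ∷ uxs) =
  AllP.map⁺ (All.tabulate (λ y∈ fx≡fy → All.lookup x∉ y∈ (f-inj (here refl) (there y∈) fx≡fy)))
  ∷ Unique-map⁺ (λ x∈ y∈ → f-inj (there x∈) (there y∈)) uxs

all-cong : ∀ {A : Set} {p q : A → Bool} l → (∀ x → x ∈ l → p x ≡ q x) → all p l ≡ all q l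
all-cong l p≗q = cong and (List.map-cong-local (All.tabulate (p≗q _)))

any-cong : ∀ {A : Set} {p q : A → Bool} l → (∀ x → x ∈ l → p x ≡ q x) → any p l ≡ any q l
any-cong l p≗q = cong or (List.map-cong-local (All.tabulate (p≗q _)))

all-split : ∀ {A : Set} (S v : A → Bool) l →
  all v l ≡ all (λ j → if S j then v j else true) l ∧ all (λ j → if S j then true else v j) l
all-split S v []      = refl
all-split S v (x ∷ l) with S x | v x
... | true  | true  = all-split S v l
... | true  | false = refl
... | false | true  = all-split S v l
... | false | false = sym (Bool.∧-zeroʳ _)

any-split : ∀ {A : Set} (S v : A → Bool) l →
  any v l ≡ any (λ j → if S j then v j else false) l ∨ any (λ j → if S j then false else v j) l
any-split S v []      = refl
any-split S v (x ∷ l) with S x | v x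
... | true  | true  = refl
... | true  | false = any-split S v l
... | false | true  = sym (Bool.∨-zeroʳ _)
... | false | false = any-split S v l

bools : List Bool
bools = true ∷ false ∷ []

∈-bools : ∀ b → b ∈ bools
∈-bools true  = here refl
∈-bools false = there (here refl)

length-cartesianProductWith : ∀ {A B C : Set} (f : A → B → C) xs ys →
  length (cartesianProductWith f xs ys) ≡ length xs * length ys
length-cartesianProductWith f []       ys = refl
length-cartesianProductWith f (x ∷ xs) ys = begin
  length (map (f x) ys ++ cartesianProductWith f xs ys)
    ≡⟨ length-++ (map (f x) ys) ⟩
  length (map (f x) ys) + length (cartesianProductWith f xs ys)
    ≡⟨ cong₂ _+_ (length-map (f x) ys) (length-cartesianProductWith f xs ys) ⟩
  length ys + length xs * length ys ∎
  where open ≡-Reasoning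

listsOfLength : ∀ {A : Set} → List A → ℕ → List (List A)
listsOfLength as zero    = [] ∷ []
listsOfLength as (suc n) = cartesianProductWith _∷_ as (listsOfLength as n)

length-listsOfLength : ∀ {A : Set} (as : List A) n → length (listsOfLength as n) ≡ length as ^ n
length-listsOfLength as zero    = refl
length-listsOfLength as (suc n) =
  trans (length-cartesianProductWith _∷_ as (listsOfLength as n)) (cong (length as *_) (length-listsOfLength as n))

∈-listsOfLength : ∀ {A : Set} {as : List A} l → All (_∈ as) l → l ∈ listsOfLength as (length l)
∈-listsOfLength []      []          = here refl
∈-listsOfLength (a ∷ l) (a∈ ∷ l∈as) = ∈-cartesianProductWith⁺ _∷_ a∈ (∈-listsOfLength l l∈as)

module _ {A : Set} (_≟_ : DecidableEquality A) where

  update : A → Bool → (A → Bool) → A → Bool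
  update x c u y = if does (y ≟ x) then c else u y

  valuations : List A → List (A → Bool)
  valuations []       = (λ _ → false) ∷ []
  valuations (x ∷ xs) = cartesianProductWith (update x) bools (valuations xs)

  length-valuations : ∀ xs → length (valuations xs) ≡ 2 ^ length xs
  length-valuations []       = refl
  length-valuations (x ∷ xs) =
    trans (length-cartesianProductWith (update x) bools (valuations xs)) (cong (2 *_) (length-valuations xs))

  valuations-complete : ∀ xs (u : A → Bool) → ∃[ v ] v ∈ valuations xs × (∀ y → y ∈ xs → v y ≡ u y)
  valuations-complete []       u = _ , here refl , λ _ ()
  valuations-complete (x ∷ xs) u with valuations-complete xs u
  ... | v , v∈ , v≗u = update x (u x) v , ∈-cartesianProductWith⁺ (update x) (∈-bools (u x)) v∈ , agree
    where
    agree : ∀ y → y ∈ x ∷ xs → update x (u x) v y ≡ u y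
    agree y y∈ with y ≟ x | y∈
    ... | yes refl | _          = refl
    ... | no  y≢x  | here y≡x   = contradiction y≡x y≢x
    ... | no  _    | there y∈xs = v≗u y y∈xs

-- Counting factors

merge-inside : ∀ Y α γ {x} → x ∈ Y → merge Y α γ x ≡ α x
merge-inside Y α γ {x} x∈Y rewrite dec-true (x ∈? Y) x∈Y = refl

merge-outside : ∀ Y α γ {x} → ¬ x ∈ Y → merge Y α γ x ≡ γ x
merge-outside Y α γ {x} x∉Y rewrite dec-false (x ∈? Y) x∉Y = refl

merge-agree : ∀ (X Y : List ℕ) {α α′ γ γ′ : Assignment} →
  (∀ x → x ∈ X → α x ≡ α′ x) → (∀ x → x ∈ X → γ x ≡ γ′ x) →
  ∀ x → x ∈ X → merge Y α γ x ≡ merge Y α′ γ′ x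
merge-agree X Y α≗α′ γ≗γ′ x x∈X with does (x ∈? Y)
... | true  = α≗α′ x x∈X
... | false = γ≗γ′ x x∈X

module Factors (X : List ℕ) (F : BoolFun) (F-over-X : DependsOnly X F) (Y : List ℕ) where

  agree⇒sameCofactor : ∀ {α α′} → (∀ x → x ∈ X → α x ≡ α′ x) → SameCofactor F Y α α′
  agree⇒sameCofactor α≗α′ γ = F-over-X _ _ (merge-agree X Y α≗α′ (λ _ _ → refl))

  representatives : List Assignment
  representatives = valuations ℕ._≟_ X

  representative : ∀ α → ∃[ α′ ] α′ ∈ representatives × SameCofactor F Y α′ α
  representative α with valuations-complete ℕ._≟_ X α
  ... | α′ , α′∈ , α′≗α = α′ , α′∈ , agree⇒sameCofactor α′≗α

  sameCofactor? : Decidable (SameCofactor F Y)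
  sameCofactor? β β′ = map′ sound complete (All.all? (λ γ → F (merge Y β γ) Bool.≟ F (merge Y β′ γ)) representatives)
    where
    sound : All (λ γ → F (merge Y β γ) ≡ F (merge Y β′ γ)) representatives → SameCofactor F Y β β′
    sound all≡ γ with valuations-complete ℕ._≟_ X γ
    ... | γ′ , γ′∈ , γ′≗γ = begin
      F (merge Y β γ)   ≡⟨ F-over-X _ _ (merge-agree X Y (λ _ _ → refl) (λ x x∈ → sym (γ′≗γ x x∈))) ⟩
      F (merge Y β γ′)  ≡⟨ All.lookup all≡ γ′∈ ⟩
      F (merge Y β′ γ′) ≡⟨ F-over-X _ _ (merge-agree X Y (λ _ _ → refl) γ′≗γ) ⟩
      F (merge Y β′ γ)  ∎
      where open ≡-Reasoning
    complete : SameCofactor F Y β β′ → All (λ γ → F (merge Y β γ) ≡ F (merge Y β′ γ)) representatives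
    complete same = All.tabulate (λ {γ} _ → same γ)

  -- The factor with witness α₀ is recovered from the information of a representative of α₀ as the
  -- set of β whose cofactor is that of some representative carrying the same information.
  factors-bounded-by-information : ∀ {I : Set} → DecidableEquality I → (info : Assignment → I) →
    (∀ β β′ → info β ≡ info β′ → SameCofactor F Y β β′) →
    (is : List I) → (∀ β → info β ∈ is) → AtMost (length is) (IsFactor F Y)
  factors-bounded-by-information {I} _≟_ info info-determines is info∈is =
    map factorOf is , ℕ.≤-reflexive (length-map factorOf is) , cover
    where
    factorOf : I → BoolFun
    factorOf φ β = does (Any.any? (λ α → (info α ≟ φ) ×-dec sameCofactor? β α) representatives)

    cover : ∀ G → IsFactor F Y G → Any (λ H → ∀ β → G β ≡ H β) (map factorOf is)
    cover G (α₀ , G-spec) with representative α₀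
    ... | α , α∈ , α∼α₀ = Any.map⁺ (lose (info∈is α) G≗factor)
      where
      G≗factor : ∀ β → G β ≡ factorOf (info α) β
      G≗factor β = ⇔→≡ (mk⇔ to from)
        where
        to : G β ≡ true → factorOf (info α) β ≡ true
        to Gβ = dec-true (Any.any? _ representatives)
                  (lose α∈ (refl , λ γ → trans (proj₁ (G-spec β) Gβ γ) (sym (α∼α₀ γ))))
        from : factorOf (info α) β ≡ true → G β ≡ true
        from e with satisfied (does-true⇒ (Any.any? _ representatives) e)
        ... | α′ , info≡ , β∼α′ = proj₂ (G-spec β)
              (λ γ → trans (β∼α′ γ) (trans (info-determines α′ α info≡ γ) (α∼α₀ γ)))

  factors-singleton : ∀ x → Y ≡ x ∷ [] → AtMost 2 (IsFactor F Y)
  factors-singleton x refl = factors-bounded-by-information Bool._≟_ (λ β → β x) same bools (λ β → ∈-bools (β x))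
    where
    same : ∀ β β′ → β x ≡ β′ x → SameCofactor F (x ∷ []) β β′
    same β β′ βx≡β′x γ = F-over-X _ _ (λ z _ → agree z)
      where
      agree : ∀ z → merge (x ∷ []) β γ z ≡ merge (x ∷ []) β′ γ z
      agree z with z ∈? (x ∷ [])
      ... | yes z∈@(here refl) = trans (merge-inside _ β γ z∈) (trans βx≡β′x (sym (merge-inside _ β′ γ z∈)))
      ... | no z∉              = trans (merge-outside _ β γ z∉) (sym (merge-outside _ β′ γ z∉))

factorBound : ℕ → ℕ
factorBound w = 2 ^ (suc w * 2 ^ w)

factorBound-mono : ∀ {m w} → m ≤ w → factorBound m ≤ factorBound w
factorBound-mono m≤w = ℕ.^-monoʳ-≤ 2 (ℕ.*-mono-≤ (ℕ.s≤s m≤w) (ℕ.^-monoʳ-≤ 2 m≤w))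

AtMost-mono : ∀ {a b P} → a ≤ b → AtMost a P → AtMost b P
AtMost-mono a≤b (L , L≤a , cover) = L , ℕ.≤-trans L≤a a≤b , cover

-- Evaluating part of a circuit

valueInside : ∀ {n} → Gates n → (Fin n → Bool) → Assignment → (Fin n → Bool) → Fin n → Bool
valueInside (g ∷ gs) S b u zero    = if S zero then evalGate g b (valueInside gs (S ∘ suc) b (u ∘ suc)) else u zero
valueInside (g ∷ gs) S b u (suc i) = valueInside gs (S ∘ suc) b (u ∘ suc) i

contribution : ∀ {n} → Gate n → (Fin n → Bool) → (Fin n → Bool) → Bool
contribution (var x)   S v = false
contribution (const c) S v = false
contribution (∧g l)    S v = all (λ j → if S j then v j else true) (toList l)
contribution (∨g l)    S v = any (λ j → if S j then v j else false) (toList l)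
contribution (¬g i)    S v = if S i then v i else false

insideContribution : ∀ {n} → Gates n → (Fin n → Bool) → Assignment → (Fin n → Bool) → Fin n → Bool
insideContribution (g ∷ gs) S b u zero    = contribution g (S ∘ suc) (valueInside gs (S ∘ suc) b (u ∘ suc))
insideContribution (g ∷ gs) S b u (suc i) = insideContribution gs (S ∘ suc) b (u ∘ suc) i

VarsAgree : ∀ {n} → Gates n → (Fin n → Bool) → Bool → Assignment → Assignment → Set
VarsAgree gs S c α α′ = ∀ {i x} → IsVar gs i x → S i ≡ c → α x ≡ α′ x

evalGate-cong : ∀ {n} (g : Gate n) α {v v′ : Fin n → Bool} → (∀ j → j ∈ inputs g → v j ≡ v′ j) →
  evalGate g α v ≡ evalGate g α v′
evalGate-cong (var x)   α v≗v′ = refl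
evalGate-cong (const c) α v≗v′ = refl
evalGate-cong (∧g l)    α v≗v′ = all-cong (toList l) v≗v′
evalGate-cong (∨g l)    α v≗v′ = any-cong (toList l) v≗v′
evalGate-cong (¬g i)    α v≗v′ = cong not (v≗v′ i (here refl))

evalGate-head : ∀ {n} {g : Gate n} {gs S c α α′} → VarsAgree (g ∷ gs) S c α α′ → S zero ≡ c →
  (v : Fin n → Bool) → evalGate g α v ≡ evalGate g α′ v
evalGate-head {g = var x}   α≗α′ S0 v = α≗α′ here S0
evalGate-head {g = const c} α≗α′ S0 v = refl
evalGate-head {g = ∧g l}    α≗α′ S0 v = refl
evalGate-head {g = ∨g l}    α≗α′ S0 v = refl
evalGate-head {g = ¬g i}    α≗α′ S0 v = refl

evalGate-contribution : ∀ {n} (g : Gate n) α S {v v′ : Fin n → Bool} →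
  (∀ j → j ∈ inputs g → S j ≡ false → v j ≡ v′ j) → contribution g S v ≡ contribution g S v′ →
  evalGate g α v ≡ evalGate g α v′
evalGate-contribution (var x)   α S v≗v′ c≡c′ = refl
evalGate-contribution (const c) α S v≗v′ c≡c′ = refl
evalGate-contribution (∧g l)    α S {v} {v′} v≗v′ c≡c′ = begin
  all v (toList l)                                                                      ≡⟨ all-split S v (toList l) ⟩
  contribution (∧g l) S v ∧ all (λ j → if S j then true else v j) (toList l)   ≡⟨ cong₂ _∧_ c≡c′ (all-cong (toList l) outside) ⟩
  contribution (∧g l) S v′ ∧ all (λ j → if S j then true else v′ j) (toList l) ≡⟨ all-split S v′ (toList l) ⟨
  all v′ (toList l)                                                                     ∎
  where
  open ≡-Reasoning
  outside : ∀ j → j ∈ toList l → (if S j then true else v j) ≡ (if S j then true else v′ j)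
  outside j j∈ with S j in Sj
  ... | true  = refl
  ... | false = v≗v′ j j∈ Sj
evalGate-contribution (∨g l)    α S {v} {v′} v≗v′ c≡c′ = begin
  any v (toList l)                                                                       ≡⟨ any-split S v (toList l) ⟩
  contribution (∨g l) S v ∨ any (λ j → if S j then false else v j) (toList l)   ≡⟨ cong₂ _∨_ c≡c′ (any-cong (toList l) outside) ⟩
  contribution (∨g l) S v′ ∨ any (λ j → if S j then false else v′ j) (toList l) ≡⟨ any-split S v′ (toList l) ⟨
  any v′ (toList l)                                                                      ∎
  where
  open ≡-Reasoning
  outside : ∀ j → j ∈ toList l → (if S j then false else v j) ≡ (if S j then false else v′ j)
  outside j j∈ with S j in Sj
  ... | true  = refl
  ... | false = v≗v′ j j∈ Sj
evalGate-contribution (¬g i)    α S v≗v′ c≡c′ with S i in Si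
... | true  = cong not c≡c′
... | false = cong not (v≗v′ i (here refl) Si)

contribution-cong : ∀ {n} (g : Gate n) S {v v′ : Fin n → Bool} →
  (∀ j → j ∈ inputs g → S j ≡ true → v j ≡ v′ j) → contribution g S v ≡ contribution g S v′
contribution-cong (var x)   S v≗v′ = refl
contribution-cong (const c) S v≗v′ = refl
contribution-cong (∧g l)    S {v} {v′} v≗v′ = all-cong (toList l) inside
  where
  inside : ∀ j → j ∈ toList l → (if S j then v j else true) ≡ (if S j then v′ j else true)
  inside j j∈ with S j in Sj
  ... | true  = v≗v′ j j∈ Sj
  ... | false = refl
contribution-cong (∨g l)    S {v} {v′} v≗v′ = any-cong (toList l) inside
  where
  inside : ∀ j → j ∈ toList l → (if S j then v j else false) ≡ (if S j then v′ j else false)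
  inside j j∈ with S j in Sj
  ... | true  = v≗v′ j j∈ Sj
  ... | false = refl
contribution-cong (¬g i)    S v≗v′ with S i in Si
... | true  = v≗v′ i (here refl) Si
... | false = refl

valueInside-outside : ∀ {n} (gs : Gates n) S b u {i} → S i ≡ false → valueInside gs S b u i ≡ u i
valueInside-outside (g ∷ gs) S b u {zero}  Si rewrite Si = refl
valueInside-outside (g ∷ gs) S b u {suc i} Si = valueInside-outside gs (S ∘ suc) b (u ∘ suc) Si

valueInside-value : ∀ {n} (gs : Gates n) S b α → VarsAgree gs S true b α →
  ∀ i → valueInside gs S b (value gs α) i ≡ value gs α i
valueInside-value (g ∷ gs) S b α b≗α zero with S zero in S0
... | false = refl
... | true  = trans (evalGate-cong g b (λ j _ → valueInside-value gs (S ∘ suc) b α (b≗α ∘ there) j))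
                    (evalGate-head b≗α S0 (value gs α))
valueInside-value (g ∷ gs) S b α b≗α (suc i) = valueInside-value gs (S ∘ suc) b α (b≗α ∘ there) i

valueInside-local : ∀ {n} (gs : Gates n) S b {u u′ : Fin n → Bool} (Boundary : Fin n → Set) →
  (∀ j → Boundary j → u j ≡ u′ j) → (∀ i j → Wire gs i j → S i ≡ true → S j ≡ false → Boundary j) →
  ∀ i → S i ≡ true → valueInside gs S b u i ≡ valueInside gs S b u′ i
valueInside-local (g ∷ gs) S b {u} {u′} Boundary u≗u′ closed zero S0 rewrite S0 = evalGate-cong g b inputs≗
  where
  inputs≗ : ∀ j → j ∈ inputs g → valueInside gs (S ∘ suc) b (u ∘ suc) j ≡ valueInside gs (S ∘ suc) b (u′ ∘ suc) j
  inputs≗ j j∈ with S (suc j) in Sj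
  ... | true  = valueInside-local gs (S ∘ suc) b (Boundary ∘ suc) (u≗u′ ∘ suc)
                  (λ i j w → closed (suc i) (suc j) (there w)) j Sj
  ... | false = begin
    valueInside gs (S ∘ suc) b (u ∘ suc) j   ≡⟨ valueInside-outside gs (S ∘ suc) b (u ∘ suc) Sj ⟩
    u (suc j)                                ≡⟨ u≗u′ (suc j) (closed zero (suc j) (here j∈) S0 Sj) ⟩
    u′ (suc j)                               ≡⟨ valueInside-outside gs (S ∘ suc) b (u′ ∘ suc) Sj ⟨
    valueInside gs (S ∘ suc) b (u′ ∘ suc) j  ∎
    where open ≡-Reasoning
valueInside-local (g ∷ gs) S b Boundary u≗u′ closed (suc i) Si =
  valueInside-local gs (S ∘ suc) b (Boundary ∘ suc) (u≗u′ ∘ suc) (λ i j w → closed (suc i) (suc j) (there w)) i Si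

insideContribution-cong : ∀ {n} (gs : Gates n) S b b′ (u u′ : Fin n → Bool) i →
  (∀ j → Wire gs i j → S j ≡ true → valueInside gs S b u j ≡ valueInside gs S b′ u′ j) →
  insideContribution gs S b u i ≡ insideContribution gs S b′ u′ i
insideContribution-cong (g ∷ gs) S b b′ u u′ zero    v≗v′ =
  contribution-cong g (S ∘ suc) (λ j j∈ → v≗v′ (suc j) (here j∈))
insideContribution-cong (g ∷ gs) S b b′ u u′ (suc i) v≗v′ =
  insideContribution-cong gs (S ∘ suc) b b′ (u ∘ suc) (u′ ∘ suc) i (λ j w → v≗v′ (suc j) (there w))

valueInside-glue : ∀ {n} (gs : Gates n) S b₁ b₂ α₁ α₂ →
  VarsAgree gs S true b₁ α₁ → VarsAgree gs S true b₂ α₂ → VarsAgree gs S false α₁ α₂ →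
  (∀ i → S i ≡ false → insideContribution gs S b₁ (value gs α₁) i ≡ insideContribution gs S b₂ (value gs α₁) i) →
  ∀ i → valueInside gs S b₂ (value gs α₁) i ≡ value gs α₂ i
valueInside-glue (g ∷ gs) S b₁ b₂ α₁ α₂ b₁≗α₁ b₂≗α₂ α₁≗α₂ same = λ where
    zero    → atHead
    (suc i) → glued i
  where
  w : Fin _ → Bool
  w = value gs α₁

  glued : ∀ i → valueInside gs (S ∘ suc) b₂ w i ≡ value gs α₂ i
  glued = valueInside-glue gs (S ∘ suc) b₁ b₂ α₁ α₂
            (b₁≗α₁ ∘ there) (b₂≗α₂ ∘ there) (α₁≗α₂ ∘ there) (same ∘ suc)

  outside : ∀ j → j ∈ inputs g → S (suc j) ≡ false → valueInside gs (S ∘ suc) b₁ w j ≡ valueInside gs (S ∘ suc) b₂ w j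
  outside j _ Sj = trans (valueInside-outside gs (S ∘ suc) b₁ w Sj) (sym (valueInside-outside gs (S ∘ suc) b₂ w Sj))

  atHead : valueInside (g ∷ gs) S b₂ (value (g ∷ gs) α₁) zero ≡ value (g ∷ gs) α₂ zero
  atHead with S zero in S0
  ... | true  = trans (evalGate-cong g b₂ (λ j _ → glued j)) (evalGate-head b₂≗α₂ S0 (value gs α₂))
  ... | false = begin
    evalGate g α₁ w                                 ≡⟨ evalGate-cong g α₁ (λ j _ → valueInside-value gs (S ∘ suc) b₁ α₁ (b₁≗α₁ ∘ there) j) ⟨
    evalGate g α₁ (valueInside gs (S ∘ suc) b₁ w)   ≡⟨ evalGate-head α₁≗α₂ S0 _ ⟩
    evalGate g α₂ (valueInside gs (S ∘ suc) b₁ w)   ≡⟨ evalGate-contribution g α₂ (S ∘ suc) outside (same zero S0) ⟩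
    evalGate g α₂ (valueInside gs (S ∘ suc) b₂ w)   ≡⟨ evalGate-cong g α₂ (λ j _ → glued j) ⟩
    evalGate g α₂ (value gs α₂)                     ∎
    where open ≡-Reasoning

-- Separators

record Separator (C : Circuit) (w : ℕ) (Y : List ℕ) : Set₁ where
  field
    Inside   : Fin (size C) → Set
    inside?  : ∀ i → Dec (Inside i)
    boundary : List (Fin (size C))
    narrow   : length boundary ≤ w
    inside⇔  : ∀ {i x} → IsVar (gates C) i x → Inside i ⇔ x ∈ Y
    closed   : ∀ {i j} → Adj C i j → Inside i → ¬ Inside j → j ∈ boundary

module _ (C : Circuit) {w : ℕ} where

  everywhere : ∀ {Y} → (∀ {i x} → IsVar (gates C) i x → x ∈ Y) → Separator C w Y
  everywhere vars∈Y = record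
    { Inside   = λ _ → ⊤
    ; inside?  = λ _ → yes tt
    ; boundary = []
    ; narrow   = ℕ.z≤n
    ; inside⇔  = λ iv → mk⇔ (λ _ → vars∈Y iv) (λ _ → tt)
    ; closed   = λ _ _ outside → contradiction tt outside
    }

  nowhere : Separator C w []
  nowhere = record
    { Inside   = λ _ → ⊥
    ; inside?  = λ _ → no (λ ())
    ; boundary = []
    ; narrow   = ℕ.z≤n
    ; inside⇔  = λ _ → mk⇔ (λ ()) (λ ())
    ; closed   = λ _ ()
    }

module FactorsOfSeparated (X : List ℕ) (F : BoolFun) (F-over-X : DependsOnly X F)
  (C : Circuit) (C-computes-F : Computes C F) {Y : List ℕ} {w : ℕ} (sep : Separator C w Y) where
  open Separator sep
  open Factors X F F-over-X Y
  private
    gs : Gates (size C)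
    gs = gates C

    out : Fin (size C)
    out = output C

    m : ℕ
    m = length boundary

    S : Fin (size C) → Bool
    S i = does (inside? i)

    S≡∈ : ∀ {i x} → IsVar gs i x → S i ≡ does (x ∈? Y)
    S≡∈ {i} {x} iv = does-⇔ (inside⇔ iv) (inside? i) (x ∈? Y)

    vars-inside : ∀ β γ → VarsAgree gs S true β (merge Y β γ)
    vars-inside β γ iv Si = sym (merge-inside Y β γ (does-true⇒ (_ ∈? Y) (trans (sym (S≡∈ iv)) Si)))

    vars-outside : ∀ β₁ β₂ γ → VarsAgree gs S false (merge Y β₁ γ) (merge Y β₂ γ)
    vars-outside β₁ β₂ γ {x = x} iv Si = trans (merge-outside Y β₁ γ x∉Y) (sym (merge-outside Y β₂ γ x∉Y))
      where
      x∉Y : ¬ x ∈ Y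
      x∉Y = does-false⇒ (x ∈? Y) (trans (sym (S≡∈ iv)) Si)

    S-closed : ∀ i j → Wire gs i j ⊎ Wire gs j i → S i ≡ true → S j ≡ false → j ∈ boundary
    S-closed i j adj Si Sj = closed adj (does-true⇒ (inside? i) Si) (does-false⇒ (inside? j) Sj)

    boundaryValuations : List (Fin (size C) → Bool)
    boundaryValuations = valuations Fin._≟_ boundary

    entry : Assignment → (Fin (size C) → Bool) → List Bool
    entry β u = valueInside gs S β u out ∷ map (insideContribution gs S β u) boundary

    info : Assignment → List (List Bool)
    info β = map (entry β) boundaryValuations

    module _ (β₁ β₂ γ : Assignment) {u : Fin (size C) → Bool}
             (u≗v : ∀ j → j ∈ boundary → u j ≡ value gs (merge Y β₁ γ) j) (entry≡ : entry β₁ u ≡ entry β₂ u) where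
      private
        α₁ α₂ : Assignment
        α₁ = merge Y β₁ γ
        α₂ = merge Y β₂ γ

        v : Fin (size C) → Bool
        v = value gs α₁

      local : ∀ β i → S i ≡ true → valueInside gs S β v i ≡ valueInside gs S β u i
      local β = valueInside-local gs S β (_∈ boundary) (λ j j∈ → sym (u≗v j j∈)) (λ i j w → S-closed i j (inj₁ w))

      contribution≡ : ∀ i → S i ≡ false → insideContribution gs S β₁ v i ≡ insideContribution gs S β₂ v i
      contribution≡ i Si with Any.any? (i Fin.≟_) boundary
      ... | yes i∈ = begin
        insideContribution gs S β₁ v i  ≡⟨ insideContribution-cong gs S β₁ β₁ v u i (λ j _ Sj → local β₁ j Sj) ⟩
        insideContribution gs S β₁ u i  ≡⟨ map-≡⇒pointwise boundary (proj₂ (List.∷-injective entry≡)) i∈ ⟩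
        insideContribution gs S β₂ u i  ≡⟨ insideContribution-cong gs S β₂ β₂ v u i (λ j _ Sj → local β₂ j Sj) ⟨
        insideContribution gs S β₂ v i  ∎
        where open ≡-Reasoning
      ... | no i∉ = insideContribution-cong gs S β₁ β₂ v v i (λ j w Sj → contradiction (S-closed j i (inj₂ w) Sj Si) i∉)

      glued : ∀ i → valueInside gs S β₂ v i ≡ value gs α₂ i
      glued = valueInside-glue gs S β₁ β₂ α₁ α₂
                (vars-inside β₁ γ) (vars-inside β₂ γ) (vars-outside β₁ β₂ γ) contribution≡

      output≡ : value gs α₁ out ≡ value gs α₂ out
      output≡ with S out in S-out
      ... | false = trans (sym (valueInside-outside gs S β₂ v S-out)) (glued out)
      ... | true  = begin
        value gs α₁ out              ≡⟨ valueInside-value gs S β₁ α₁ (vars-inside β₁ γ) out ⟨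
        valueInside gs S β₁ v out    ≡⟨ local β₁ out S-out ⟩
        valueInside gs S β₁ u out    ≡⟨ proj₁ (List.∷-injective entry≡) ⟩
        valueInside gs S β₂ u out    ≡⟨ local β₂ out S-out ⟨
        valueInside gs S β₂ v out    ≡⟨ glued out ⟩
        value gs α₂ out              ∎
        where open ≡-Reasoning

    info-determines : ∀ β₁ β₂ → info β₁ ≡ info β₂ → SameCofactor F Y β₁ β₂
    info-determines β₁ β₂ info≡ γ with valuations-complete Fin._≟_ boundary (value gs (merge Y β₁ γ))
    ... | u , u∈ , u≗v = begin
      F (merge Y β₁ γ)             ≡⟨ C-computes-F _ ⟨
      value gs (merge Y β₁ γ) out  ≡⟨ output≡ β₁ β₂ γ u≗v (map-≡⇒pointwise boundaryValuations info≡ u∈) ⟩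
      value gs (merge Y β₂ γ) out  ≡⟨ C-computes-F _ ⟩
      F (merge Y β₂ γ)             ∎
      where open ≡-Reasoning

    infos : List (List (List Bool))
    infos = listsOfLength (listsOfLength bools (suc m)) (length boundaryValuations)

    info∈infos : ∀ β → info β ∈ infos
    info∈infos β = subst (λ l → info β ∈ listsOfLength _ l) (length-map (entry β) boundaryValuations)
      (∈-listsOfLength (info β) (AllP.map⁺ (All.tabulate (λ {u} _ → entry∈ u))))
      where
      entry∈ : ∀ u → entry β u ∈ listsOfLength bools (suc m)
      entry∈ u = subst (λ l → entry β u ∈ listsOfLength bools (suc l)) (length-map _ boundary)
        (∈-listsOfLength (entry β u) (All.tabulate (λ {b} _ → ∈-bools b)))

    length-infos : length infos ≡ factorBound m
    length-infos = begin
      length infos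
        ≡⟨ length-listsOfLength _ (length boundaryValuations) ⟩
      length (listsOfLength bools (suc m)) ^ length boundaryValuations
        ≡⟨ cong₂ _^_ (length-listsOfLength bools (suc m)) (length-valuations Fin._≟_ boundary) ⟩
      (2 ^ suc m) ^ 2 ^ m
        ≡⟨ ℕ.^-*-assoc 2 (suc m) (2 ^ m) ⟩
      2 ^ (suc m * 2 ^ m) ∎
      where open ≡-Reasoning

  factors-separated : AtMost (factorBound w) (IsFactor F Y)
  factors-separated = AtMost-mono (factorBound-mono narrow)
    (subst (λ N → AtMost N (IsFactor F Y)) length-infos
      (factors-bounded-by-information (List.≡-dec (List.≡-dec Bool._≟_)) info info-determines infos info∈infos))

-- Vtrees as combs

Forest : Set
Forest = List VTree

forestLeaves : Forest → List ℕ
forestLeaves []       = []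
forestLeaves (t ∷ ts) = leaves t ++ forestLeaves ts

forestLeaves-++ : ∀ ts us → forestLeaves (ts ++ us) ≡ forestLeaves ts ++ forestLeaves us
forestLeaves-++ []       us = refl
forestLeaves-++ (t ∷ ts) us = trans (cong (leaves t ++_) (forestLeaves-++ ts us)) (sym (List.++-assoc (leaves t) _ _))

forestLeaves-leaves-++ : ∀ {A : Set} (f : A → ℕ) xs ts → forestLeaves (map (leaf ∘ f) xs ++ ts) ≡ map f xs ++ forestLeaves ts
forestLeaves-leaves-++ f []       ts = refl
forestLeaves-leaves-++ f (x ∷ xs) ts = cong (f x ∷_) (forestLeaves-leaves-++ f xs ts)

comb : VTree → Forest → VTree
comb t []       = t
comb t (u ∷ us) = node₂ t (comb u us)

leaves-comb : ∀ t ts → leaves (comb t ts) ≡ forestLeaves (t ∷ ts)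
leaves-comb t []       = sym (List.++-identityʳ (leaves t))
leaves-comb t (u ∷ us) = cong (leaves t ++_) (leaves-comb u us)

combine : Forest → Forest
combine []       = []
combine (t ∷ ts) = comb t ts ∷ []

forestLeaves-combine : ∀ ts → forestLeaves (combine ts) ≡ forestLeaves ts
forestLeaves-combine []       = refl
forestLeaves-combine (t ∷ ts) = trans (List.++-identityʳ (leaves (comb t ts))) (leaves-comb t ts)

-- The leaf 0 stands in for the empty forest.
fromForest : Forest → VTree
fromForest []       = leaf 0
fromForest (t ∷ ts) = comb t ts

⊆-leaves-fromForest : ∀ ts {x} → x ∈ forestLeaves ts → x ∈ leaves (fromForest ts)
⊆-leaves-fromForest (t ∷ ts) {x} = subst (x ∈_) (sym (leaves-comb t ts))

unique-leaves-fromForest : ∀ ts → Unique (forestLeaves ts) → Unique (leaves (fromForest ts))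
unique-leaves-fromForest []       _ = [] ∷ []
unique-leaves-fromForest (t ∷ ts)   = subst Unique (sym (leaves-comb t ts))

data Suffix {A : Set} : List A → List A → Set where
  whole : ∀ {l} → Suffix l l
  skip  : ∀ {s x l} → Suffix s l → Suffix s (x ∷ l)

module _ {A : Set} where

  Suffix-[] : ∀ (l : List A) → Suffix [] l
  Suffix-[] []      = whole
  Suffix-[] (x ∷ l) = skip (Suffix-[] l)

  Suffix⇒⊆ : ∀ {s l : List A} {x} → Suffix s l → x ∈ s → x ∈ l
  Suffix⇒⊆ whole    x∈ = x∈
  Suffix⇒⊆ (skip q) x∈ = there (Suffix⇒⊆ q x∈)

  Suffix-++ : ∀ (l₁ l₂ : List A) {s} → Suffix s (l₁ ++ l₂) →
    (∃[ s₁ ] Suffix s₁ l₁ × s ≡ s₁ ++ l₂) ⊎ Suffix s l₂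
  Suffix-++ []       l₂ q        = inj₂ q
  Suffix-++ (x ∷ l₁) l₂ whole    = inj₁ (x ∷ l₁ , whole , refl)
  Suffix-++ (x ∷ l₁) l₂ (skip q) with Suffix-++ l₁ l₂ q
  ... | inj₁ (s₁ , q₁ , refl) = inj₁ (s₁ , skip q₁ , refl)
  ... | inj₂ q₂               = inj₂ q₂

  Suffix-map : ∀ {B : Set} (f : A → B) (l : List A) {s} → Suffix s (map f l) → ∃[ s′ ] Suffix s′ l × s ≡ map f s′
  Suffix-map f []      whole    = [] , whole , refl
  Suffix-map f (x ∷ l) whole    = x ∷ l , whole , refl
  Suffix-map f (x ∷ l) (skip q) with Suffix-map f l q
  ... | s′ , q′ , refl = s′ , skip q′ , refl

Suffix-combine : ∀ ts {s} → Suffix s (combine ts) → s ≡ combine ts ⊎ s ≡ []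
Suffix-combine []       whole        = inj₁ refl
Suffix-combine (t ∷ ts) whole        = inj₁ refl
Suffix-combine (t ∷ ts) (skip whole) = inj₂ refl

AllNodes : ∀ {ℓ} → (List ℕ → Set ℓ) → VTree → Set ℓ
AllNodes P t = ∀ v → v ⊑ t → P (leaves v)

-- Every node of a comb is a node of one of its teeth or spans a suffix of them.
comb-allNodes : ∀ {ℓ} {P : List ℕ → Set ℓ} t ts → All (AllNodes P) (t ∷ ts) →
  (∀ {s} → Suffix s (t ∷ ts) → P (forestLeaves s)) → AllNodes P (comb t ts)
comb-allNodes t []       (Pt ∷ [])  Psuffix = Pt
comb-allNodes {P = P} t (u ∷ us) (Pt ∷ Pus) Psuffix v here = subst P (sym (leaves-comb t (u ∷ us))) (Psuffix whole)
comb-allNodes t (u ∷ us) (Pt ∷ Pus) Psuffix v (inˡ v⊑t) = Pt v v⊑t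
comb-allNodes {P = P} t (u ∷ us) (Pt ∷ Pus) Psuffix v (inʳ v⊑c) = comb-allNodes {P = P} u us Pus (Psuffix ∘ skip) v v⊑c

combine-allNodes : ∀ {ℓ} {P : List ℕ → Set ℓ} ts → All (AllNodes P) ts →
  (∀ {s} → Suffix s ts → P (forestLeaves s)) → All (AllNodes P) (combine ts)
combine-allNodes []       _       _       = []
combine-allNodes {P = P} (t ∷ ts) Pts Psuffix = comb-allNodes {P = P} t ts Pts Psuffix ∷ []

fromForest-allNodes : ∀ {ℓ} {P : List ℕ → Set ℓ} ts → P (0 ∷ []) → All (AllNodes P) ts →
  (∀ {s} → Suffix s ts → P (forestLeaves s)) → AllNodes P (fromForest ts)
fromForest-allNodes []       P0 _   _       v here = P0
fromForest-allNodes {P = P} (t ∷ ts) P0 Pts Psuffix = comb-allNodes {P = P} t ts Pts Psuffix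

module _ {n : ℕ} where

  td-induction : ∀ {ℓ} (Q : TD n → Set ℓ) → (∀ B ts → All Q ts → Q (node B ts)) → ∀ t → Q t
  td-induction Q step = onTree
    where
    mutual
      onTree : ∀ t → Q t
      onTree (node B ts) = step B ts (onTrees ts)

      onTrees : ∀ ts → All Q ts
      onTrees []       = []
      onTrees (t ∷ ts) = onTree t ∷ onTrees ts

  Any-bagsList⁺ : ∀ {Q : Subset n → Set} {c ts} → c ∈ ts → Any Q (bags c) → Any Q (bagsList ts)
  Any-bagsList⁺ {ts = c ∷ ts} (here refl) q = Any.++⁺ˡ q
  Any-bagsList⁺ {ts = c ∷ ts} (there c∈)  q = Any.++⁺ʳ (bags c) (Any-bagsList⁺ c∈ q)

  Any-bagsList⁻ : ∀ {Q : Subset n → Set} ts → Any Q (bagsList ts) → ∃[ c ] c ∈ ts × Any Q (bags c)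
  Any-bagsList⁻ (c ∷ ts) q with Any.++⁻ (bags c) q
  ... | inj₁ q-c  = c , here refl , q-c
  ... | inj₂ q-ts with Any-bagsList⁻ ts q-ts
  ...   | c′ , c′∈ , q-c′ = c′ , there c′∈ , q-c′

  Occurs-child : ∀ {i c B ts} → c ∈ ts → Occurs i c → Occurs i (node B ts)
  Occurs-child c∈ oc = there (Any-bagsList⁺ c∈ oc)

  ConnectedAll⇒All : ∀ {v : Fin n} ts → ConnectedAll v ts → All (Connected v) ts
  ConnectedAll⇒All []       _            = []
  ConnectedAll⇒All (t ∷ ts) (ct , cts) = ct ∷ ConnectedAll⇒All ts cts

AtMostOne-unique : ∀ {A : Set} {P : A → Set} {l x y} → AtMostOne P l → x ∈ l → y ∈ l → P x → P y → x ≡ y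
AtMostOne-unique amo         (here refl) (here refl) Px Py = refl
AtMostOne-unique (amo , _)   (here refl) (there y∈) Px Py = contradiction Py (All.lookup (amo Px) y∈)
AtMostOne-unique (amo , _)   (there x∈) (here refl) Px Py = contradiction Px (All.lookup (amo Py) x∈)
AtMostOne-unique (_ , amo)   (there x∈) (there y∈)  Px Py = AtMostOne-unique amo x∈ y∈ Px Py

members : ∀ {n} → Subset n → List (Fin n)
members []          = []
members (true ∷ p)  = zero ∷ map suc (members p)
members (false ∷ p) = map suc (members p)

∈-members : ∀ {n} {i : Fin n} {p} → i ∈ₛ p → i ∈ members p
∈-members {p = true ∷ p}  here       = here refl
∈-members {p = true ∷ p}  (there i∈) = there (∈-map⁺ suc (∈-members i∈))
∈-members {p = false ∷ p} (there i∈) = ∈-map⁺ suc (∈-members i∈)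

length-members : ∀ {n} (p : Subset n) → length (members p) ≡ ∣ p ∣
length-members []          = refl
length-members (true ∷ p)  = cong suc (trans (length-map suc (members p)) (length-members p))
length-members (false ∷ p) = trans (length-map suc (members p)) (length-members p)

-- The vtree of a tree decomposition

gateVar : ∀ {n} → Gate n → Maybe ℕ
gateVar (var x) = just x
gateVar _       = nothing

varOf : ∀ {n} → Gates n → Fin n → Maybe ℕ
varOf (g ∷ gs) zero    = gateVar g
varOf (g ∷ gs) (suc i) = varOf gs i

IsVar⇒varOf : ∀ {n} {gs : Gates n} {i x} → IsVar gs i x → varOf gs i ≡ just x
IsVar⇒varOf here       = refl
IsVar⇒varOf (there iv) = IsVar⇒varOf iv

varOf⇒IsVar : ∀ {n} (gs : Gates n) i {x} → varOf gs i ≡ just x → IsVar gs i x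
varOf⇒IsVar (var y ∷ gs) zero    refl = here
varOf⇒IsVar (g ∷ gs)     (suc i) e    = there (varOf⇒IsVar gs i e)

module VtreeOfDecomposition (C : Circuit) (distinct : ∀ i j x → IsVar (gates C) i x → IsVar (gates C) j x → i ≡ j) (k : ℕ) where

  private
    n : ℕ
    n = size C

    gs : Gates n
    gs = gates C

  Separable : List ℕ → Set₁
  Separable Y = (∃[ x ] Y ≡ x ∷ []) ⊎ Separator C (suc k) Y

  -- 0 is a junk value on gates that are not variable gates.
  label : Fin n → ℕ
  label i = fromMaybe 0 (varOf gs i)

  IsVarGate : Fin n → Set
  IsVarGate i = varOf gs i ≡ just (label i)

  IsVar⇒label : ∀ {i x} → IsVar gs i x → label i ≡ x
  IsVar⇒label iv rewrite IsVar⇒varOf iv = refl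

  IsVar⇒IsVarGate : ∀ {i x} → IsVar gs i x → IsVarGate i
  IsVar⇒IsVarGate iv rewrite IsVar⇒varOf iv = refl

  IsVarGate⇒IsVar : ∀ {i} → IsVarGate i → IsVar gs i (label i)
  IsVarGate⇒IsVar {i} = varOf⇒IsVar gs i

  label-injective : ∀ {i j} → IsVarGate i → IsVarGate j → label i ≡ label j → i ≡ j
  label-injective {i} {j} vi vj li≡lj = distinct i j (label j) (subst (IsVar gs i) li≡lj (IsVarGate⇒IsVar vi)) (IsVarGate⇒IsVar vj)

  Introduced : Subset n → Subset n → Fin n → Set
  Introduced B P i = i ∈ₛ B × i ∉ₛ P × IsVarGate i

  introduced? : ∀ B P i → Dec (Introduced B P i)
  introduced? B P i = (i ∈ₛ? B) ×-dec (¬? (i ∈ₛ? P)) ×-dec (Maybe.≡-dec ℕ._≟_ (varOf gs i) (just (label i)))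

  introduced : Subset n → Subset n → List (Fin n)
  introduced B P = filter (introduced? B P) (allFin n)

  ∈-introduced⁻ : ∀ {B P i} → i ∈ introduced B P → Introduced B P i
  ∈-introduced⁻ {B} {P} = proj₂ ∘ ∈-filter⁻ (introduced? B P) {xs = allFin n}

  ∈-introduced⁺ : ∀ {B P i} → Introduced B P i → i ∈ introduced B P
  ∈-introduced⁺ {B} {P} {i} = ∈-filter⁺ (introduced? B P) (∈-allFin i)

  mutual
    items : TD n → Subset n → Forest
    items (node B ts) P = map (leaf ∘ label) (introduced B P) ++ childForest ts B

    childForest : List (TD n) → Subset n → Forest
    childForest []       B = []
    childForest (c ∷ cs) B = combine (items c B) ++ childForest cs B

  forestLeaves-items : ∀ B ts P →
    forestLeaves (items (node B ts) P) ≡ map label (introduced B P) ++ forestLeaves (childForest ts B)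
  forestLeaves-items B ts P = forestLeaves-leaves-++ label (introduced B P) (childForest ts B)

  forestLeaves-childForest : ∀ c cs B →
    forestLeaves (childForest (c ∷ cs) B) ≡ forestLeaves (items c B) ++ forestLeaves (childForest cs B)
  forestLeaves-childForest c cs B =
    trans (forestLeaves-++ (combine (items c B)) _) (cong (_++ _) (forestLeaves-combine (items c B)))

  ∈-childForest⁻ : ∀ ts {B x} → x ∈ forestLeaves (childForest ts B) → ∃[ c ] c ∈ ts × x ∈ forestLeaves (items c B)
  ∈-childForest⁻ (c ∷ cs) {B} x∈ with ∈-++⁻ (forestLeaves (items c B)) (subst (_ ∈_) (forestLeaves-childForest c cs B) x∈)
  ... | inj₁ x∈c  = c , here refl , x∈c
  ... | inj₂ x∈cs with ∈-childForest⁻ cs x∈cs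
  ...   | c′ , c′∈ , x∈c′ = c′ , there c′∈ , x∈c′

  ∈-childForest⁺ : ∀ ts {B x c} → c ∈ ts → x ∈ forestLeaves (items c B) → x ∈ forestLeaves (childForest ts B)
  ∈-childForest⁺ (c ∷ cs) {B} {x} (here refl) x∈c =
    subst (x ∈_) (sym (forestLeaves-childForest c cs B)) (∈-++⁺ˡ x∈c)
  ∈-childForest⁺ (c ∷ cs) {B} {x} (there c′∈) x∈c′ =
    subst (x ∈_) (sym (forestLeaves-childForest c cs B)) (∈-++⁺ʳ (forestLeaves (items c B)) (∈-childForest⁺ cs c′∈ x∈c′))

  -- t is a subtree, hanging below the bag P, of a decomposition of C of width at most k.
  record Branch (t : TD n) (P : Subset n) : Set where
    field
      connected : ∀ v → Connected v t
      rooted    : ∀ {i} → i ∈ₛ P → Occurs i t → i ∈ₛ root t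
      covers    : ∀ {i j} → Adj C i j → Occurs i t → i ∉ₛ P → Any (λ B → i ∈ₛ B × j ∈ₛ B) (bags t)
      narrow    : All (λ B → ∣ B ∣ ≤ suc k) (bags t)

  module _ {B ts P} (br : Branch (node B ts) P) where
    open Branch br

    unique-child : ∀ {i c c′} → i ∉ₛ B → c ∈ ts → c′ ∈ ts → Occurs i c → Occurs i c′ → c ≡ c′
    unique-child {i} i∉B = AtMostOne-unique (proj₂ (proj₂ (connected i)) i∉B)

    outside-parent : ∀ {i c} → i ∉ₛ B → c ∈ ts → Occurs i c → i ∉ₛ P
    outside-parent i∉B c∈ oc i∈P = i∉B (rooted i∈P (Occurs-child c∈ oc))

    covers-child : ∀ {i j c} → Adj C i j → i ∉ₛ B → c ∈ ts → Occurs i c →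
      Any (λ B′ → i ∈ₛ B′ × j ∈ₛ B′) (bags c)
    covers-child adj i∉B c∈ oc with covers adj (Occurs-child c∈ oc) (outside-parent i∉B c∈ oc)
    ... | here (i∈B , _) = contradiction i∈B i∉B
    ... | there q with Any-bagsList⁻ ts q
    ...   | c′ , c′∈ , q′ rewrite unique-child i∉B c∈ c′∈ oc (Any.map proj₁ q′) = q′

    branch-child : ∀ {c} → c ∈ ts → Branch c B
    branch-child c∈ = record
      { connected = λ v → All.lookup (ConnectedAll⇒All ts (proj₁ (connected v))) c∈
      ; rooted    = λ {i} i∈B → All.lookup (proj₁ (proj₂ (connected i)) i∈B) c∈
      ; covers    = λ adj oc i∉B → covers-child adj i∉B c∈ oc
      ; narrow    = All.tabulate (λ B′∈ → All.lookup narrow (there (Any-bagsList⁺ c∈ B′∈)))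
      }

  VarOccurs : TD n → Subset n → ℕ → Set
  VarOccurs t P x = ∃[ i ] IsVar gs i x × Occurs i t × i ∉ₛ P

  ∈-items : ∀ t {P x} → Branch t P → x ∈ forestLeaves (items t P) ⇔ VarOccurs t P x
  ∈-items = td-induction (λ t → ∀ {P x} → Branch t P → x ∈ forestLeaves (items t P) ⇔ VarOccurs t P x) step
    where
    step : ∀ B ts → All (λ c → ∀ {P x} → Branch c P → x ∈ forestLeaves (items c P) ⇔ VarOccurs c P x) ts →
           ∀ {P x} → Branch (node B ts) P → x ∈ forestLeaves (items (node B ts) P) ⇔ VarOccurs (node B ts) P x
    step B ts IH {P} {x} br = mk⇔ to from
      where
      child : ∀ {c} → c ∈ ts → x ∈ forestLeaves (items c B) ⇔ VarOccurs c B x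
      child c∈ = All.lookup IH c∈ (branch-child br c∈)

      to : x ∈ forestLeaves (items (node B ts) P) → VarOccurs (node B ts) P x
      to x∈ with ∈-++⁻ (map label (introduced B P)) (subst (x ∈_) (forestLeaves-items B ts P) x∈)
      ... | inj₁ x∈intro with ∈-map⁻ label x∈intro
      ...   | i , i∈ , refl with ∈-introduced⁻ i∈
      ...     | i∈B , i∉P , vi = i , IsVarGate⇒IsVar vi , here i∈B , i∉P
      to x∈ | inj₂ x∈children with ∈-childForest⁻ ts x∈children
      ... | c , c∈ , x∈c with Equivalence.to (child c∈) x∈c
      ...   | i , iv , oc , i∉B = i , iv , Occurs-child c∈ oc , outside-parent br i∉B c∈ oc

      from : VarOccurs (node B ts) P x → x ∈ forestLeaves (items (node B ts) P)
      from (i , iv , oc , i∉P) = subst (x ∈_) (sym (forestLeaves-items B ts P)) (place (i ∈ₛ? B) oc)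
        where
        place : Dec (i ∈ₛ B) → Occurs i (node B ts) → x ∈ map label (introduced B P) ++ forestLeaves (childForest ts B)
        place (yes i∈B) _ =
          ∈-++⁺ˡ (subst (_∈ _) (IsVar⇒label iv) (∈-map⁺ label (∈-introduced⁺ (i∈B , i∉P , IsVar⇒IsVarGate iv))))
        place (no i∉B) (here i∈B) = contradiction i∈B i∉B
        place (no i∉B) (there q) with Any-bagsList⁻ ts q
        ... | c , c∈ , oc-c = ∈-++⁺ʳ _ (∈-childForest⁺ ts c∈ (Equivalence.from (child c∈) (i , iv , oc-c , i∉B)))

  unique-childForest : ∀ {B} cs → All (λ c → Branch c B × Unique (forestLeaves (items c B))) cs →
    (∀ {i} → i ∉ₛ B → AtMostOne (Occurs i) cs) → Unique (forestLeaves (childForest cs B))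
  unique-childForest []       _                     _   = []
  unique-childForest {B} (c ∷ cs) ((br-c , u-c) ∷ hyps) amo =
    subst Unique (sym (forestLeaves-childForest c cs B))
      (Unique.++⁺ u-c (unique-childForest cs hyps (proj₂ ∘ amo)) disjoint)
    where
    disjoint : Disjoint (forestLeaves (items c B)) (forestLeaves (childForest cs B))
    disjoint {x} (x∈c , x∈cs) with ∈-childForest⁻ cs x∈cs
    ... | c′ , c′∈ , x∈c′
      with Equivalence.to (∈-items c br-c) x∈c | Equivalence.to (∈-items c′ (proj₁ (All.lookup hyps c′∈))) x∈c′
    ...   | i , iv , oc , i∉B | j , jv , oc′ , _ rewrite distinct i j x iv jv =
      All.lookup (proj₁ (amo i∉B) oc) c′∈ oc′

  unique-items : ∀ t {P} → Branch t P → Unique (forestLeaves (items t P))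
  unique-items = td-induction (λ t → ∀ {P} → Branch t P → Unique (forestLeaves (items t P))) step
    where
    step : ∀ B ts → All (λ c → ∀ {P} → Branch c P → Unique (forestLeaves (items c P))) ts →
           ∀ {P} → Branch (node B ts) P → Unique (forestLeaves (items (node B ts) P))
    step B ts IH {P} br = subst Unique (sym (forestLeaves-items B ts P))
      (Unique.++⁺ unique-introduced
        (unique-childForest ts (All.tabulate (λ c∈ → branch-child br c∈ , All.lookup IH c∈ (branch-child br c∈)))
                               (λ {i} → proj₂ (proj₂ (Branch.connected br i))))
        disjoint)
      where
      unique-introduced : Unique (map label (introduced B P))
      unique-introduced =
        Unique-map⁺ (λ i∈ j∈ → label-injective (proj₂ (proj₂ (∈-introduced⁻ i∈))) (proj₂ (proj₂ (∈-introduced⁻ j∈))))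
                    (Unique.filter⁺ (introduced? B P) (Unique.allFin⁺ n))
      disjoint : Disjoint (map label (introduced B P)) (forestLeaves (childForest ts B))
      disjoint {x} (x∈intro , x∈children) with ∈-map⁻ label x∈intro | ∈-childForest⁻ ts x∈children
      ... | i , i∈ , refl | c , c∈ , x∈c with ∈-introduced⁻ i∈ | Equivalence.to (∈-items c (branch-child br c∈)) x∈c
      ...   | i∈B , _ , vi | j , jv , _ , j∉B rewrite distinct i j (label i) (IsVarGate⇒IsVar vi) jv = j∉B i∈B

  Suffix-childForest : ∀ ts {B s} → Suffix s (childForest ts B) →
    ∃[ ts′ ] Suffix ts′ ts × forestLeaves s ≡ forestLeaves (childForest ts′ B)
  Suffix-childForest []       whole = [] , whole , refl
  Suffix-childForest (c ∷ cs) {B} q with Suffix-++ (combine (items c B)) (childForest cs B) q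
  ... | inj₂ q₂ with Suffix-childForest cs q₂
  ...   | ts′ , q′ , leaves≡ = ts′ , skip q′ , leaves≡
  Suffix-childForest (c ∷ cs) {B} q | inj₁ (s₁ , q₁ , refl) with Suffix-combine (items c B) q₁
  ... | inj₁ refl = c ∷ cs , whole , refl
  ... | inj₂ refl = cs , skip whole , refl

  -- A node of the comb built at the decomposition node with bag B spans the gates of a suffix vs of
  -- the introduced ones together with the gates below a suffix ts′ of the children that are not in
  -- B; by connectedness, every edge leaving these gates ends in B.
  nodeSeparator : ∀ {B ts P} → Branch (node B ts) P → ∀ {vs ts′} → Suffix vs (introduced B P) → Suffix ts′ ts →
    vs ≡ [] ⊎ ts′ ≡ ts → Separator C (suc k) (map label vs ++ forestLeaves (childForest ts′ B))
  nodeSeparator {B} {ts} {P} br {vs} {ts′} vs≼ ts′≼ vs-or-all = record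
    { Inside   = Inside
    ; inside?  = inside?
    ; boundary = members B
    ; narrow   = ℕ.≤-trans (ℕ.≤-reflexive (length-members B)) (All.head (Branch.narrow br))
    ; inside⇔  = inside⇔
    ; closed   = closed
    }
    where
    Inside : Fin n → Set
    Inside i = i ∈ vs ⊎ (Any (Occurs i) ts′ × i ∉ₛ B)

    inside? : ∀ i → Dec (Inside i)
    inside? i = Any.any? (i Fin.≟_) vs ⊎-dec (Any.any? (λ c → Any.any? (i ∈ₛ?_) (bags c)) ts′ ×-dec ¬? (i ∈ₛ? B))

    branch : ∀ {c} → c ∈ ts′ → Branch c B
    branch = branch-child br ∘ Suffix⇒⊆ ts′≼

    inside⇔ : ∀ {i x} → IsVar gs i x → Inside i ⇔ x ∈ map label vs ++ forestLeaves (childForest ts′ B)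
    inside⇔ {i} {x} iv = mk⇔ to from
      where
      to : Inside i → x ∈ map label vs ++ forestLeaves (childForest ts′ B)
      to (inj₁ i∈vs) = ∈-++⁺ˡ (subst (_∈ _) (IsVar⇒label iv) (∈-map⁺ label i∈vs))
      to (inj₂ (oc , i∉B)) with find oc
      ... | c , c∈ , oc-c =
        ∈-++⁺ʳ _ (∈-childForest⁺ ts′ c∈ (Equivalence.from (∈-items c (branch c∈)) (i , iv , oc-c , i∉B)))

      from : x ∈ map label vs ++ forestLeaves (childForest ts′ B) → Inside i
      from x∈ with ∈-++⁻ (map label vs) x∈
      ... | inj₁ x∈vs with ∈-map⁻ label x∈vs
      ...   | j , j∈ , refl with ∈-introduced⁻ (Suffix⇒⊆ vs≼ j∈)
      ...     | _ , _ , vj rewrite distinct i j _ iv (IsVarGate⇒IsVar vj) = inj₁ j∈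
      from x∈ | inj₂ x∈children with ∈-childForest⁻ ts′ x∈children
      ... | c , c∈ , x∈c with Equivalence.to (∈-items c (branch c∈)) x∈c
      ...   | j , jv , oc , j∉B rewrite distinct i j x iv jv = inj₂ (lose c∈ oc , j∉B)

    closed : ∀ {i j} → Adj C i j → Inside i → ¬ Inside j → j ∈ members B
    closed {i} {j} adj inside-i outside-j with j ∈ₛ? B
    ... | yes j∈B = ∈-members j∈B
    ... | no  j∉B = contradiction (inj₂ (reach inside-i , j∉B)) outside-j
      where
      reach : Inside i → Any (Occurs j) ts′
      reach (inj₁ i∈vs) = fromIntroduced vs-or-all (∈-introduced⁻ (Suffix⇒⊆ vs≼ i∈vs))
        where
        fromIntroduced : vs ≡ [] ⊎ ts′ ≡ ts → Introduced B P i → Any (Occurs j) ts′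
        fromIntroduced (inj₁ vs≡[]) _ = contradiction (subst (i ∈_) vs≡[] i∈vs) (λ ())
        fromIntroduced (inj₂ ts′≡ts) (i∈B , i∉P , _) with Branch.covers br adj (here i∈B) i∉P
        ... | here (_ , j∈B) = contradiction j∈B j∉B
        ... | there q with Any-bagsList⁻ ts q
        ...   | c , c∈ , q-c = lose (subst (c ∈_) (sym ts′≡ts) c∈) (Any.map proj₂ q-c)
      reach (inj₂ (oc , i∉B)) with find oc
      ... | c , c∈ , oc-c = lose c∈ (Any.map proj₂ (covers-child br adj i∉B (Suffix⇒⊆ ts′≼ c∈) oc-c))

  suffix-separable : ∀ t {P} → Branch t P → ∀ {s} → Suffix s (items t P) → Separable (forestLeaves s)
  suffix-separable (node B ts) {P} br q with Suffix-++ (map (leaf ∘ label) (introduced B P)) (childForest ts B) q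
  ... | inj₁ (s₁ , q₁ , refl) with Suffix-map (leaf ∘ label) (introduced B P) q₁
  ...   | vs , q-vs , refl = inj₂ (subst (Separator C (suc k)) (sym (forestLeaves-leaves-++ label vs (childForest ts B)))
                                    (nodeSeparator br q-vs whole (inj₂ refl)))
  suffix-separable (node B ts) {P} br q | inj₂ q₂ with Suffix-childForest ts q₂
  ... | ts′ , q′ , leaves≡ = inj₂ (subst (Separator C (suc k)) (sym leaves≡) (nodeSeparator br (Suffix-[] _) q′ (inj₁ refl)))

  leaf-separable : ∀ x → AllNodes Separable (leaf x)
  leaf-separable x v here = inj₁ (x , refl)

  trees-separable : ∀ t {P} → Branch t P → All (AllNodes Separable) (items t P)
  trees-separable = td-induction (λ t → ∀ {P} → Branch t P → All (AllNodes Separable) (items t P)) step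
    where
    step : ∀ B ts → All (λ c → ∀ {P} → Branch c P → All (AllNodes Separable) (items c P)) ts →
           ∀ {P} → Branch (node B ts) P → All (AllNodes Separable) (items (node B ts) P)
    step B ts IH {P} br =
      AllP.++⁺ (AllP.map⁺ (All.tabulate (λ {i} _ → leaf-separable (label i)))) (childrenSeparable ts (λ c∈ → c∈))
      where
      childrenSeparable : ∀ cs → (∀ {c} → c ∈ cs → c ∈ ts) → All (AllNodes Separable) (childForest cs B)
      childrenSeparable []       _    = []
      childrenSeparable (c ∷ cs) ⊆ts =
        AllP.++⁺ (combine-allNodes {P = Separable} (items c B) (All.lookup IH c∈ts br-c) (suffix-separable c br-c))
                 (childrenSeparable cs (⊆ts ∘ there))
        where
        c∈ts : c ∈ ts
        c∈ts = ⊆ts (here refl)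

        br-c : Branch c B
        br-c = branch-child br c∈ts

  module _ (X : List ℕ) (D : TD n) (occurs : ∀ i → Occurs i D) (br : Branch D ∅) where

    circuitVars : List ℕ
    circuitVars = forestLeaves (items D ∅)

    extra? : ∀ x → Dec (¬ x ∈ circuitVars)
    extra? x = ¬? (x ∈? circuitVars)

    extras : List ℕ
    extras = deduplicate ℕ._≟_ (filter extra? X)

    top : Forest
    top = map leaf extras ++ combine (items D ∅)

    forestLeaves-top : forestLeaves top ≡ extras ++ circuitVars
    forestLeaves-top = trans (forestLeaves-leaves-++ (λ x → x) extras _)
                             (cong₂ _++_ (List.map-id extras) (forestLeaves-combine (items D ∅)))

    unique-top : Unique (leaves (fromForest top))
    unique-top = unique-leaves-fromForest top (subst Unique (sym forestLeaves-top)
      (Unique.++⁺ (deduplicate-! ℕ._≟_ _) (unique-items D br)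
        (λ (x∈extras , x∈circuit) → proj₂ (∈-filter⁻ extra? {xs = X} (∈-deduplicate⁻ _ _ x∈extras)) x∈circuit)))

    ⊆-top : ∀ x → x ∈ X → x ∈ leaves (fromForest top)
    ⊆-top x x∈X = ⊆-leaves-fromForest top (subst (x ∈_) (sym forestLeaves-top) (place (x ∈? circuitVars)))
      where
      place : Dec (x ∈ circuitVars) → x ∈ extras ++ circuitVars
      place (yes x∈) = ∈-++⁺ʳ extras x∈
      place (no  x∉) = ∈-++⁺ˡ (∈-deduplicate⁺ ℕ._≟_ (∈-filter⁺ extra? x∈X x∉))

    circuit-separable : ∀ s₁ → Separable (forestLeaves (s₁ ++ combine (items D ∅)))
    circuit-separable s₁ = inj₂ (everywhere C λ {i} {x} iv →
      subst (x ∈_) (sym (trans (forestLeaves-++ s₁ _) (cong (_ ++_) (forestLeaves-combine (items D ∅)))))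
        (∈-++⁺ʳ _ (Equivalence.from (∈-items D br) (i , iv , occurs i , ∉⊥))))

    suffix-top : ∀ {s} → Suffix s top → Separable (forestLeaves s)
    suffix-top q with Suffix-++ (map leaf extras) (combine (items D ∅)) q
    ... | inj₁ (s₁ , _ , refl) = circuit-separable s₁
    ... | inj₂ q₂ with Suffix-combine (items D ∅) q₂
    ...   | inj₁ refl = circuit-separable []
    ...   | inj₂ refl = inj₂ (nowhere C)

    separable-top : AllNodes Separable (fromForest top)
    separable-top = fromForest-allNodes {P = Separable} top (inj₁ (0 , refl))
      (AllP.++⁺ (AllP.map⁺ (All.tabulate (λ {x} _ → leaf-separable x)))
                (combine-allNodes {P = Separable} (items D ∅) (trees-separable D br) (suffix-separable D br)))
      suffix-top

  vtree : (X : List ℕ) (D : TD n) → TreeDecWidthAtMost C D k →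
    Σ VTree λ T → Unique (leaves T) × (∀ x → x ∈ X → x ∈ leaves T) × AllNodes Separable T
  vtree X D (occurs , edges , connected , narrow) =
    fromForest (top X D occurs br) , unique-top X D occurs br , ⊆-top X D occurs br , separable-top X D occurs br
    where
    br : Branch D ∅
    br = record
      { connected = connected
      ; rooted    = λ i∈∅ _ → contradiction i∈∅ ∉⊥
      ; covers    = λ {i} {j} adj _ _ → edges i j adj
      ; narrow    = narrow
      }

lemma1 : (X : List ℕ) (F : BoolFun) → DependsOnly X F →
         (C : Circuit) → CircuitOver X C → Computes C F →
         (k : ℕ) (D : TD (size C)) → TreeDecWidthAtMost C D k →
         FwAtMost X F (2 ^ ((k + 2) * 2 ^ (k + 1)))
lemma1 X F F-over-X C (distinct , _) C-computes-F k D D-width with VtreeOfDecomposition.vtree C distinct k X D D-width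
... | T , unique , X⊆T , separable = T , unique , X⊆T , λ v v⊑T → factors (separable v v⊑T)
  where
  open VtreeOfDecomposition C distinct k using (Separable)

  bound≡ : factorBound (suc k) ≡ 2 ^ ((k + 2) * 2 ^ (k + 1))
  bound≡ = cong₂ (λ a b → 2 ^ (a * 2 ^ b)) (ℕ.+-comm 2 k) (ℕ.+-comm 1 k)

  factors : ∀ {Y} → Separable Y → AtMost (2 ^ ((k + 2) * 2 ^ (k + 1))) (IsFactor F Y)
  factors {Y} separable-Y = subst (λ N → AtMost N (IsFactor F Y)) bound≡ (factorsOf separable-Y)
    where
    factorsOf : Separable Y → AtMost (factorBound (suc k)) (IsFactor F Y)
    factorsOf (inj₁ (x , Y≡[x])) =
      AtMost-mono (factorBound-mono {0} {suc k} ℕ.z≤n) (Factors.factors-singleton X F F-over-X Y x Y≡[x])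
    factorsOf (inj₂ sep) = FactorsOfSeparated.factors-separated X F F-over-X C C-computes-F {w = suc k} sep
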